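{- Let $T$ be a tree with color classes $A$ and $B$, $|A|\le |B|$, $a=|A|$, and $k=\delta(A)=\min_{x\in A}d_T(x)\ge 2$. Let $\tilde T\in\mathcal{H}(T)$ be obtained from $T$ by a vertex split on a set $U\subseteq V(T)$, and let $S=U\cap A$ be the set of split vertices lying in $A$. If $|S|\ge 1$, then $\nu(\tilde T)\ge a-1+k$.
   Context: A vertex split on a vertex $v$ replaces $v$ by an independent set of $d(v)$ new vertices, each adjacent to exactly one distinct vertex of $N(v)$; the splitting family $\mathcal{H}(T)$ consists of all graphs obtained from $T$ by applying vertex splits to the vertices of some subset $U\subseteq V(T)$ one by one. $\nu(\cdot)$ denotes the matching number. -}

module Defs where

open import Data.Bool using (Bool; true; false; not; T)
open import Data.Nat using (ℕ; _≤_)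
open import Data.Fin using (Fin)
open import Data.Fin.Properties using () renaming (_≟_ to _≟ᶠ_)
open import Data.List using (List; []; _∷_; _++_; length; filterᵇ; map)
open import Data.List.Relation.Unary.Linked using (Linked)
open import Data.List.Relation.Unary.AllPairs using (AllPairs)
open import Data.List.Relation.Unary.All using (All)
open import Data.List.Relation.Unary.Unique.Propositional using (Unique)
open import Data.List.Membership.Propositional using (_∈_)
open import Data.List using (allFin)
open import Data.Product using (Σ; ∃; _×_; _,_; proj₁; proj₂)
open import Data.Sum using (_⊎_; inj₁; inj₂)
open import Data.Unit using (tt)
open import Data.Empty using (⊥)
open import Relation.Nullary using (Dec; yes; no; ¬_)
open import Relation.Nullary.Decidable using (⌊_⌋)
open import Relation.Binary.Definitions using (DecidableEquality)
open import Relation.Binary.PropositionalEquality using (_≡_; _≢_; refl; cong)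

record Graph : Set₁ where
  field
    V   : Set
    _≟_ : DecidableEquality V
    adj : V → V → Bool
open Graph public

T-irr : ∀ {b} (p q : T b) → p ≡ q
T-irr {true} tt tt = refl

Σ-T-≟ : ∀ {A : Set} {p : A → Bool} → DecidableEquality A →
        DecidableEquality (Σ A (λ a → T (p a)))
Σ-T-≟ d (a , x) (b , y) with d a b
... | yes refl = yes (cong (a ,_) (T-irr x y))
... | no a≢b = no (λ { refl → a≢b refl })

⊎-≟ : ∀ {A B : Set} → DecidableEquality A → DecidableEquality B →
      DecidableEquality (A ⊎ B)
⊎-≟ dA dB (inj₁ x) (inj₁ y) with dA x y
... | yes refl = yes refl
... | no ne = no (λ { refl → ne refl })
⊎-≟ dA dB (inj₁ x) (inj₂ y) = no (λ ())
⊎-≟ dA dB (inj₂ x) (inj₁ y) = no (λ ())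
⊎-≟ dA dB (inj₂ x) (inj₂ y) with dB x y
... | yes refl = yes refl
... | no ne = no (λ { refl → ne refl })

-- Vertex split of v in G: v is replaced by an independent set of d(v)
-- new vertices, one for each neighbour w of v, adjacent exactly to w.

Rest : (G : Graph) → V G → Set
Rest G v = Σ (V G) (λ u → T (not ⌊ _≟_ G u v ⌋))

Copies : (G : Graph) → V G → Set
Copies G v = Σ (V G) (λ w → T (adj G v w))

split : (G : Graph) → V G → Graph
split G v = record
  { V   = Rest G v ⊎ Copies G v
  ; _≟_ = ⊎-≟ (Σ-T-≟ (_≟_ G)) (Σ-T-≟ (_≟_ G))
  ; adj = a'
  }
  where
  a' : Rest G v ⊎ Copies G v → Rest G v ⊎ Copies G v → Bool
  a' (inj₁ (x , _)) (inj₁ (y , _)) = adj G x y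
  a' (inj₁ (x , _)) (inj₂ (w , _)) = ⌊ _≟_ G x w ⌋
  a' (inj₂ (w , _)) (inj₁ (x , _)) = ⌊ _≟_ G w x ⌋
  a' (inj₂ _)       (inj₂ _)       = false

-- SplitsOn G U H : H is obtained from G by applying vertex splits to the
-- vertices of U (a list of distinct original vertices) one by one, in the
-- order given by the list.  After splitting v, each remaining original
-- vertex u ≠ v is still present in the new graph as inj₁ (u , _).
data SplitsOn : (G : Graph) → List (V G) → Graph → Set₁ where
  none : ∀ {G} → SplitsOn G [] G
  step : ∀ {G H} (v : V G) (us : List (Rest G v)) →
         SplitsOn (split G v) (map inj₁ us) H →
         SplitsOn G (v ∷ map proj₁ us) H

-- Matchings; ν(H) ≥ m  iff  H has a matching with m edges.

Disjoint : ∀ {A : Set} → A × A → A × A → Set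
Disjoint (x , y) (x' , y') = x ≢ x' × x ≢ y' × y ≢ x' × y ≢ y'

IsMatching : (H : Graph) → List (V H × V H) → Set
IsMatching H M = All (λ e → T (adj H (proj₁ e) (proj₂ e))) M × AllPairs Disjoint M

matchingNumber≥ : Graph → ℕ → Set
matchingNumber≥ H m = Σ (List (V H × V H)) (λ M → IsMatching H M × length M ≡ m)

module _ {n : ℕ} (ad : Fin n → Fin n → Bool) where

  toGraph : Graph
  toGraph = record { V = Fin n ; _≟_ = _≟ᶠ_ ; adj = ad }

  Simple : Set
  Simple = (∀ x y → ad x y ≡ ad y x) × (∀ x → ad x x ≡ false)

  data Walk : Fin n → Fin n → Set where
    here : ∀ {x} → Walk x x
    step : ∀ {x y z} → T (ad x y) → Walk y z → Walk x z

  Connected : Set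
  Connected = ∀ x y → Walk x y

  -- a cycle v0 v1 v2 … vk v0 with k ≥ 2 and v0,…,vk distinct
  HasCycle : Set
  HasCycle = Σ (List (Fin n)) λ c → Σ (Fin n) λ v0 → Σ (Fin n) λ v1 → Σ (Fin n) λ v2 →
             Σ (List (Fin n)) λ rest → c ≡ v0 ∷ v1 ∷ v2 ∷ rest ×
             Unique c × Linked (λ x y → T (ad x y)) (c ++ v0 ∷ [])

  IsTree : Set
  IsTree = Simple × Connected × ¬ HasCycle

  degree : Fin n → ℕ
  degree x = length (filterᵇ (ad x) (allFin n))

  -- col is a proper 2-colouring; A = {x | col x ≡ false}, B = {x | col x ≡ true}
  ProperColouring : (Fin n → Bool) → Set
  ProperColouring col = ∀ x y → T (ad x y) → col x ≢ col y

  IsMinDegOn : (Fin n → Bool) → ℕ → Set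
  IsMinDegOn inA k = (∀ x → T (inA x) → k ≤ degree x) ×
                     Σ (Fin n) (λ x → T (inA x) × degree x ≡ k)

sizeOf : ∀ {n} → (Fin n → Bool) → ℕ
sizeOf {n} p = length (filterᵇ p (allFin n))

-- Root T at a split vertex v ∈ A and let the parent of a vertex be its neighbour on a shortest
-- path to v; as T is acyclic, every edge joins a vertex to its parent.  Every x ∈ A other than v
-- has degree ≥ 2, hence a neighbour child x ≠ parent x, and parent (child x) = x makes the edges
-- x (child x) pairwise disjoint.  They also avoid the k edges from v to its neighbours, whose
-- parent is v.  These a − 1 + k edges of T meet only at v, in distinct neighbours, so they form a
-- matching once v is split; splitting further vertices never makes disjoint edges meet.
module Submission where

open import Defs
open import Data.Bool using (Bool; true; false; not; T)
open import Data.Bool.Properties using (T-irrelevant; T-not-≡; ¬-not)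
open import Data.Nat using (ℕ; zero; suc; _≤_; _<_; z≤n; s≤s; s≤s⁻¹; _+_; _∸_)
open import Data.Nat.Properties
  using (≤-antisym; ≤-trans; <-irrefl; <-cmp; ≤-reflexive; n≤0⇒n≡0; n<1+n; m<n⇒m<1+n; suc-injective; m≤n⇒m⊓n≡m)
open import Data.Fin using (Fin)
open import Data.Fin.Properties using (any?) renaming (_≟_ to _≟ᶠ_)
open import Data.List using (List; []; _∷_; _++_; length; map; filter; filterᵇ; allFin; take)
open import Data.List.Properties using (length-map; length-++; length-take; filter-all)
open import Data.List.Relation.Unary.All as All using (All; []; _∷_)
import Data.List.Relation.Unary.All.Properties as All
open import Data.List.Relation.Unary.AllPairs as AllPairs using (AllPairs; []; _∷_)
import Data.List.Relation.Unary.AllPairs.Properties as AllPairs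
open import Data.List.Relation.Unary.Any using (here; there)
open import Data.List.Relation.Unary.Linked using (Linked; [-]; _∷_)
open import Data.List.Relation.Unary.Unique.Propositional using (Unique)
import Data.List.Relation.Unary.Unique.Propositional.Properties as Unique
open import Data.List.Membership.Propositional using (_∈_)
open import Data.List.Membership.Propositional.Properties using (∈-map⁺; ∈-map⁻; ∈-filter⁺; ∈-allFin)
open import Data.Product using (Σ; Σ-syntax; ∃-syntax; _×_; _,_; proj₁; proj₂)
open import Data.Sum using (_⊎_; inj₁; inj₂)
open import Data.Empty using (⊥-elim)
open import Function using (_∘_; _on_; Equivalence)
open import Relation.Nullary using (¬_; Dec; yes; no; ¬?)
open import Relation.Nullary.Decidable using (fromWitness; fromWitnessFalse; _⊎-dec_; _×-dec_; T?)
open import Relation.Unary using (Decidable)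
open import Relation.Binary.Definitions using (DecidableEquality; tri<; tri≈; tri>)
open import Relation.Binary.PropositionalEquality
  using (_≡_; _≢_; refl; sym; trans; cong; cong₂; subst; ≢-sym; module ≡-Reasoning)

least-witness : ∀ {P : ℕ → Set} → Decidable P → ∀ {m} → P m →
                Σ ℕ λ l → P l × (∀ {j} → P j → l ≤ j)
least-witness P? {m} pm with P? 0
... | yes p0 = 0 , p0 , λ _ → z≤n
least-witness P? {zero}  p0 | no ¬p0 = ⊥-elim (¬p0 p0)
least-witness P? {suc m} pm | no ¬p0 with least-witness (P? ∘ suc) pm
... | l , pl , minimal = suc l , pl , λ { {zero} p0 → ⊥-elim (¬p0 p0) ; {suc j} pj → s≤s (minimal pj) }

allPairs-within : ∀ {A : Set} {P : A → Set} {R S : A → A → Set} →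
                  (∀ {x y} → P x → P y → S x y → R x y) →
                  ∀ {xs} → All P xs → AllPairs S xs → AllPairs R xs
allPairs-within f []         []         = []
allPairs-within f (px ∷ pxs) (sx ∷ sxs) =
  All.zipWith (λ (py , s) → f px py s) (pxs , sx) ∷ allPairs-within f pxs sxs

linked-∷ʳ : ∀ {A : Set} {R : A → A → Set} x ys {y z} →
            Linked R (x ∷ ys ++ y ∷ []) → R y z → Linked R ((x ∷ ys ++ y ∷ []) ++ z ∷ [])
linked-∷ʳ x []       (xRy ∷ [-])     yRz = xRy ∷ yRz ∷ [-]
linked-∷ʳ x (w ∷ ws) (xRw ∷ linked) yRz = xRw ∷ linked-∷ʳ w ws linked yRz

module _ {A : Set} (_≟_ : DecidableEquality A) where

  length-remove : ∀ {v xs} → Unique xs → v ∈ xs →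
                  length xs ≡ suc (length (filter (λ x → ¬? (x ≟ v)) xs))
  length-remove {v} {v ∷ xs} (v∉xs ∷ _) (here refl) with v ≟ v
  ... | yes _ = cong (suc ∘ length) (sym (filter-all (λ x → ¬? (x ≟ v)) (All.map ≢-sym v∉xs)))
  ... | no v≢v = ⊥-elim (v≢v refl)
  length-remove {v} {x ∷ xs} (x∉xs ∷ xs!) (there v∈xs) with x ≟ v
  ... | yes refl = ⊥-elim (All.lookup x∉xs v∈xs refl)
  ... | no _ = cong suc (length-remove xs! v∈xs)

  -- junk value q when ys has fewer than two elements
  another : A → List A → A
  another q (a ∷ b ∷ _) with a ≟ q
  ... | yes _ = b
  ... | no _  = a
  another q _ = q

  another-spec : ∀ q {ys} → 2 ≤ length ys → Unique ys → another q ys ∈ ys × another q ys ≢ q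
  another-spec q {a ∷ b ∷ _} _ ((a≢b ∷ _) ∷ _) with a ≟ q
  ... | yes refl = there (here refl) , λ b≡a → a≢b (sym b≡a)
  ... | no a≢q  = here refl , a≢q
  another-spec q {_ ∷ []} (s≤s ()) _

-- Vertex splitting

module _ (G : Graph) where

  Adjacent : V G × V G → Set
  Adjacent e = T (adj G (proj₁ e) (proj₂ e))

  Edge : Set
  Edge = Σ (V G × V G) Adjacent

  Undirected : Set
  Undirected = ∀ x y → T (adj G x y) → T (adj G y x)

  Loopless : Set
  Loopless = ∀ x → ¬ T (adj G x x)

module _ {n : ℕ} {ad : Fin n → Fin n → Bool} (simple : Simple ad) where

  simple⇒undirected : Undirected (toGraph ad)
  simple⇒undirected x y = subst T (proj₁ simple x y)

  simple⇒loopless : Loopless (toGraph ad)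
  simple⇒loopless x = subst T (proj₂ simple x)

-- The end a of an edge a a′ and the end b of an edge b b′ may coincide only at a vertex of U
-- that is going to be split, and then a′ ≢ b′ makes the two ends distinct copies.
EndsApart : {A : Set} → List A → (a a′ b b′ : A) → Set
EndsApart U a a′ b b′ = a ≡ b → a ∈ U × a′ ≢ b′

DisjointAfterSplitting : {A : Set} → List A → A × A → A × A → Set
DisjointAfterSplitting U (x , y) (x′ , y′) =
  EndsApart U x y x′ y′ × EndsApart U x y y′ x′ × EndsApart U y x x′ y′ × EndsApart U y x y′ x′

ends-apart : ∀ {A : Set} {U : List A} {a a′ b b′} → a ≢ b → EndsApart U a a′ b b′
ends-apart a≢b a≡b = ⊥-elim (a≢b a≡b)

disjoint-after-splitting-[] : ∀ {A : Set} {e e′ : A × A} → DisjointAfterSplitting [] e e′ → Disjoint e e′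
disjoint-after-splitting-[] (p , q , r , s) =
  (λ ()) ∘ proj₁ ∘ p , (λ ()) ∘ proj₁ ∘ q , (λ ()) ∘ proj₁ ∘ r , (λ ()) ∘ proj₁ ∘ s

module _ {G : Graph} (v : V G) where

  endpoint : ∀ x y → T (adj G x y) → V (split G v)
  endpoint x y xy with _≟_ G x v
  ... | yes refl = inj₂ (y , xy)
  ... | no x≢v  = inj₁ (x , fromWitnessFalse x≢v)

  endpoint-injective : ∀ {x y x′ y′} (xy : T (adj G x y)) (x′y′ : T (adj G x′ y′)) →
                       endpoint x y xy ≡ endpoint x′ y′ x′y′ → x ≡ x′ × (x ≡ v → y ≡ y′)
  endpoint-injective {x} {x′ = x′} xy x′y′ eq with _≟_ G x v | _≟_ G x′ v
  endpoint-injective _ _ refl | yes refl | yes refl = refl , λ _ → refl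
  endpoint-injective _ _ refl | no x≢v  | no _     = refl , λ x≡v → ⊥-elim (x≢v x≡v)
  endpoint-injective _ _ ()   | yes refl | no _
  endpoint-injective _ _ ()   | no _     | yes refl

  endpoint-adjacent : Loopless G → ∀ {x y} (xy : T (adj G x y)) (yx : T (adj G y x)) →
                      T (adj (split G v) (endpoint x y xy) (endpoint y x yx))
  endpoint-adjacent loopless {x} {y} xy yx with _≟_ G x v | _≟_ G y v
  ... | yes refl | yes refl = loopless x xy
  ... | yes refl | no _     = fromWitness refl
  ... | no _     | yes refl = fromWitness refl
  ... | no _     | no _     = xy

  split-undirected : Undirected G → Undirected (split G v)
  split-undirected undirected (inj₁ (x , _)) (inj₁ (y , _)) xy = undirected x y xy
  split-undirected undirected (inj₁ (x , _)) (inj₂ (w , _)) xw with _≟_ G x w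
  ... | yes refl = fromWitness refl
  split-undirected undirected (inj₂ (w , _)) (inj₁ (x , _)) wx with _≟_ G w x
  ... | yes refl = fromWitness refl
  split-undirected undirected (inj₂ _) (inj₂ _) ()

  split-loopless : Loopless G → Loopless (split G v)
  split-loopless loopless (inj₁ (x , _)) = loopless x
  split-loopless loopless (inj₂ _) ()

  module _ (us : List (Rest G v)) where

    endpoint-∈ : ∀ {x y} (xy : T (adj G x y)) → x ≢ v → x ∈ map proj₁ us → endpoint x y xy ∈ map inj₁ us
    endpoint-∈ {x} xy x≢v x∈us with _≟_ G x v | ∈-map⁻ proj₁ x∈us
    ... | yes x≡v | _ = ⊥-elim (x≢v x≡v)
    ... | no _    | (.x , q) , xq∈us , refl =
      subst (λ q → inj₁ (x , q) ∈ map inj₁ us) (T-irrelevant q _) (∈-map⁺ inj₁ xq∈us)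

    ends-apart-after-split : ∀ {x y x′ y′} (xy : T (adj G x y)) (yx : T (adj G y x))
                             (x′y′ : T (adj G x′ y′)) (y′x′ : T (adj G y′ x′)) →
                             EndsApart (v ∷ map proj₁ us) x y x′ y′ →
                             EndsApart (map inj₁ us) (endpoint x y xy) (endpoint y x yx)
                                                     (endpoint x′ y′ x′y′) (endpoint y′ x′ y′x′)
    ends-apart-after-split xy yx x′y′ y′x′ apart same
      with endpoint-injective xy x′y′ same
    ... | refl , same-other with apart refl
    ... | here x≡v     , y≢y′ = ⊥-elim (y≢y′ (same-other x≡v))
    ... | there x∈rest , y≢y′ =
      endpoint-∈ xy (y≢y′ ∘ same-other) x∈rest , y≢y′ ∘ proj₁ ∘ endpoint-injective yx y′x′

    module _ (undirected : Undirected G) (loopless : Loopless G) where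

      image : Edge G → Edge (split G v)
      image ((x , y) , xy) = (endpoint x y xy , endpoint y x yx) , endpoint-adjacent loopless xy yx
        where
        yx : T (adj G y x)
        yx = undirected x y xy

      image-disjoint : ∀ {e e′} → DisjointAfterSplitting (v ∷ map proj₁ us) (proj₁ e) (proj₁ e′) →
                       DisjointAfterSplitting (map inj₁ us) (proj₁ (image e)) (proj₁ (image e′))
      image-disjoint {(x , y) , xy} {(x′ , y′) , x′y′} (p , q , r , s) =
        ends-apart-after-split xy yx x′y′ y′x′ p , ends-apart-after-split xy yx y′x′ x′y′ q ,
        ends-apart-after-split yx xy x′y′ y′x′ r , ends-apart-after-split yx xy y′x′ x′y′ s
        where
        yx : T (adj G y x)
        yx = undirected x y xy
        y′x′ : T (adj G y′ x′)
        y′x′ = undirected x′ y′ x′y′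

splitting-separates-edges : ∀ {G U H} → SplitsOn G U H → Undirected G → Loopless G →
                            (M : List (Edge G)) → AllPairs (DisjointAfterSplitting U on proj₁) M →
                            matchingNumber≥ H (length M)
splitting-separates-edges none _ _ M apart =
  map proj₁ M ,
  (All.map⁺ (All.universal proj₂ M) , AllPairs.map⁺ (AllPairs.map disjoint-after-splitting-[] apart)) ,
  length-map proj₁ M
splitting-separates-edges {H = H} (step v us splits) undirected loopless M apart =
  subst (matchingNumber≥ H) (length-map (image v us undirected loopless) M)
    (splitting-separates-edges splits (split-undirected v undirected) (split-loopless v loopless)
      (map (image v us undirected loopless) M)
      (AllPairs.map⁺ (AllPairs.map (image-disjoint v us undirected loopless) apart)))

map-proj₁-toList : ∀ {A : Set} {P : A → Set} {xs} (pxs : All P xs) → map proj₁ (All.toList pxs) ≡ xs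
map-proj₁-toList []         = refl
map-proj₁-toList (_ ∷ pxs) = cong (_ ∷_) (map-proj₁-toList pxs)

splitting-separates : ∀ {G U H} → SplitsOn G U H → Undirected G → Loopless G →
                      (M : List (V G × V G)) → All (Adjacent G) M →
                      AllPairs (DisjointAfterSplitting U) M → matchingNumber≥ H (length M)
splitting-separates {G} {U} {H} splits undirected loopless M adjacent apart =
  subst (matchingNumber≥ H) (trans (sym (length-map proj₁ edges)) (cong length edges≡M))
    (splitting-separates-edges splits undirected loopless edges
      (AllPairs.map⁻ (subst (AllPairs (DisjointAfterSplitting U)) (sym edges≡M) apart)))
  where
  edges : List (Edge G)
  edges = All.toList adjacent
  edges≡M : map proj₁ edges ≡ M
  edges≡M = map-proj₁-toList adjacent

-- Rooted trees

module _ {n : ℕ} (ad : Fin n → Fin n → Bool) where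

  closed-path⇒cycle : ∀ {x y z} zs → Unique (x ∷ y ∷ zs ++ z ∷ []) →
                      Linked (λ a b → T (ad a b)) (x ∷ y ∷ zs ++ z ∷ []) → T (ad z x) → HasCycle ad
  closed-path⇒cycle {x} {y} {z} []       u linked zx =
    _ , x , y , z , [] , refl , u , linked-∷ʳ x (y ∷ []) linked zx
  closed-path⇒cycle {x} {y} {z} (w ∷ ws) u linked zx =
    _ , x , y , w , ws ++ z ∷ [] , refl , u , linked-∷ʳ x (y ∷ w ∷ ws) linked zx

module RootedTree {n : ℕ} (ad : Fin n → Fin n → Bool) (tree : IsTree ad) (root : Fin n) where

  _~_ : Fin n → Fin n → Set
  x ~ y = T (ad x y)

  ~-sym : ∀ {x y} → x ~ y → y ~ x
  ~-sym = simple⇒undirected (proj₁ tree) _ _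

  ~-irrefl : ∀ {x} → ¬ x ~ x
  ~-irrefl = simple⇒loopless (proj₁ tree) _

  ~⇒≢ : ∀ {x y} → x ~ y → x ≢ y
  ~⇒≢ xy refl = ~-irrefl xy

  connected : Connected ad
  connected = proj₁ (proj₂ tree)

  acyclic : ¬ HasCycle ad
  acyclic = proj₂ (proj₂ tree)

  Reach : ℕ → Fin n → Set
  Reach zero    x = x ≡ root
  Reach (suc l) x = x ≡ root ⊎ ∃[ y ] x ~ y × Reach l y

  reach? : ∀ l → Decidable (Reach l)
  reach? zero    x = x ≟ᶠ root
  reach? (suc l) x = x ≟ᶠ root ⊎-dec any? (λ y → T? (ad x y) ×-dec reach? l y)

  walk⇒reach : ∀ {x} → Walk ad x root → ∃[ l ] Reach l x
  walk⇒reach here = 0 , refl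
  walk⇒reach (step xy walk) with walk⇒reach walk
  ... | l , reach = suc l , inj₂ (_ , xy , reach)

  shortest-reach : ∀ x → Σ ℕ λ l → Reach l x × (∀ {j} → Reach j x → l ≤ j)
  shortest-reach x = least-witness (λ l → reach? l x) (proj₂ (walk⇒reach (connected x root)))

  dist : Fin n → ℕ
  dist x = proj₁ (shortest-reach x)

  dist-reach : ∀ x → Reach (dist x) x
  dist-reach x = proj₁ (proj₂ (shortest-reach x))

  dist-minimal : ∀ {l x} → Reach l x → dist x ≤ l
  dist-minimal {x = x} = proj₂ (proj₂ (shortest-reach x))

  dist-root : dist root ≡ 0
  dist-root = n≤0⇒n≡0 (dist-minimal refl)

  dist≡0⇒root : ∀ {x} → dist x ≡ 0 → x ≡ root
  dist≡0⇒root {x} d≡0 = subst (λ l → Reach l x) d≡0 (dist-reach x)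

  dist≡suc⇒≢root : ∀ {x l} → dist x ≡ suc l → x ≢ root
  dist≡suc⇒≢root d≡suc refl with trans (sym dist-root) d≡suc
  ... | ()

  dist-adjacent : ∀ {x y} → x ~ y → dist y ≤ suc (dist x)
  dist-adjacent {x} xy = dist-minimal (inj₂ (x , ~-sym xy , dist-reach x))

  closer-neighbour : ∀ {x} → x ≢ root → ∃[ y ] x ~ y × dist x ≡ suc (dist y)
  closer-neighbour {x} x≢root with dist x in dx | dist-reach x
  ... | zero  | x≡root = ⊥-elim (x≢root x≡root)
  ... | suc l | inj₁ x≡root = ⊥-elim (x≢root x≡root)
  ... | suc l | inj₂ (y , xy , reach-y) = y , xy , cong suc (≤-antisym l≤dist-y (dist-minimal reach-y))
    where
    l≤dist-y : l ≤ dist y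
    l≤dist-y = s≤s⁻¹ (subst (_≤ suc (dist y)) dx (dist-adjacent (~-sym xy)))

  -- The decision is an argument because `with x ≟ᶠ root` would also abstract it inside dist x.
  parent-given : ∀ x → Dec (x ≡ root) → Fin n
  parent-given x (yes _)     = root
  parent-given x (no x≢root) = proj₁ (closer-neighbour x≢root)

  -- junk value: the root is its own parent
  parent : Fin n → Fin n
  parent x = parent-given x (x ≟ᶠ root)

  parent-root : parent root ≡ root
  parent-root with root ≟ᶠ root
  ... | yes _        = refl
  ... | no root≢root = ⊥-elim (root≢root refl)

  parent-spec : ∀ {x} → x ≢ root → x ~ parent x × dist x ≡ suc (dist (parent x))
  parent-spec {x} x≢root = given (x ≟ᶠ root)
    where
    given : (x≟root : Dec (x ≡ root)) →
            x ~ parent-given x x≟root × dist x ≡ suc (dist (parent-given x x≟root))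
    given (yes x≡root) = ⊥-elim (x≢root x≡root)
    given (no x≢root′) = proj₂ (closer-neighbour x≢root′)

  climb : ∀ {x l} → dist x ≡ suc l → x ~ parent x × dist (parent x) ≡ l
  climb {x} dx with parent-spec (dist≡suc⇒≢root {x} dx)
  ... | x~p , dx≡ = x~p , suc-injective (trans (sym dx≡) dx)

  level-≢ : ∀ {L x z} → dist x ≡ L → dist z < L → x ≢ z
  level-≢ refl below refl = <-irrefl refl below

  unique-between : ∀ {L x x′ zs} → dist x ≡ L → dist x′ ≡ L → x ≢ x′ →
                   Unique zs → All (λ z → dist z < L) zs → Unique (x ∷ zs ++ x′ ∷ [])
  unique-between dx dx′ x≢x′ zs! below =
    All.++⁺ (All.map (level-≢ dx) below) (x≢x′ ∷ []) ∷
    AllPairs.++⁺ zs! ([] ∷ []) (All.map (λ z-below → ≢-sym (level-≢ dx′ z-below) ∷ []) below)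

  Bridge : ℕ → Fin n → Fin n → Set
  Bridge L x x′ = Σ[ m ∈ Fin n ] Σ[ zs ∈ List (Fin n) ]
                  Linked _~_ (x ∷ m ∷ zs ++ x′ ∷ []) × Unique (m ∷ zs) × All (λ z → dist z < L) (m ∷ zs)

  -- climb from x and x′ towards the root until the two branches meet
  bridge : ∀ {L x x′} → dist x ≡ L → dist x′ ≡ L → x ≢ x′ → Bridge L x x′
  bridge {zero} dx dx′ x≢x′ = ⊥-elim (x≢x′ (trans (dist≡0⇒root dx) (sym (dist≡0⇒root dx′))))
  bridge {suc l} {x} {x′} dx dx′ x≢x′ with climb {x} dx | climb {x′} dx′ | parent x ≟ᶠ parent x′
  ... | x~p , dp | x′~p′ , dp′ | yes p≡p′ =
    parent x , [] , x~p ∷ subst (_~ x′) (sym p≡p′) (~-sym x′~p′) ∷ [-] , [] ∷ [] ,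
    s≤s (≤-reflexive dp) ∷ []
  ... | x~p , dp | x′~p′ , dp′ | no p≢p′ with bridge dp dp′ p≢p′
  ... | m , zs , linked , zs! , below =
    parent x , m ∷ zs ++ parent x′ ∷ [] ,
    x~p ∷ linked-∷ʳ (parent x) (m ∷ zs) linked (~-sym x′~p′) ,
    unique-between dp dp′ p≢p′ zs! below ,
    s≤s (≤-reflexive dp) ∷ All.++⁺ (All.map m<n⇒m<1+n below) (s≤s (≤-reflexive dp′) ∷ [])

  same-level⇒¬adjacent : ∀ {x y} → x ~ y → dist x ≢ dist y
  same-level⇒¬adjacent {x} {y} xy dx≡dy with bridge {x = x} refl (sym dx≡dy) (~⇒≢ xy)
  ... | m , zs , linked , zs! , below =
    acyclic (closed-path⇒cycle ad zs (unique-between {x = x} refl (sym dx≡dy) (~⇒≢ xy) zs! below)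
                                     linked (~-sym xy))

  child⇒parent : ∀ {x w} → x ~ w → dist w ≡ suc (dist x) → parent w ≡ x
  child⇒parent {x} {w} xw dw with climb {w} dw | parent w ≟ᶠ x
  ... | _ , _ | yes p≡x = p≡x
  ... | w~p , dp | no p≢x with bridge {x = x} refl dp (≢-sym p≢x)
  ... | m , zs , linked , zs! , below =
    ⊥-elim (acyclic (closed-path⇒cycle ad (m ∷ zs) (w∉path ∷ path!) (~-sym xw ∷ linked) (~-sym w~p)))
    where
    path! : Unique (x ∷ m ∷ zs ++ parent w ∷ [])
    path! = unique-between {x = x} refl dp (≢-sym p≢x) zs! below
    w∉path : All (w ≢_) (x ∷ m ∷ zs ++ parent w ∷ [])
    w∉path = All.map (level-≢ {x = w} dw)
                     (n<1+n _ ∷ All.++⁺ (All.map m<n⇒m<1+n below) (s≤s (≤-reflexive dp) ∷ []))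

  adjacent⇒parent : ∀ {x y} → x ~ y → parent y ≡ x ⊎ parent x ≡ y
  adjacent⇒parent {x} {y} xy with <-cmp (dist x) (dist y)
  ... | tri< x<y _ _ = inj₁ (child⇒parent xy (≤-antisym (dist-adjacent xy) x<y))
  ... | tri≈ _ x≡y _ = ⊥-elim (same-level⇒¬adjacent xy x≡y)
  ... | tri> _ _ y<x = inj₂ (child⇒parent (~-sym xy) (≤-antisym (dist-adjacent (~-sym xy)) y<x))

  parent-of-neighbour : ∀ {x y} → x ~ y → y ≢ parent x → parent y ≡ x
  parent-of-neighbour xy y≢p with adjacent⇒parent xy
  ... | inj₁ p≡x = p≡x
  ... | inj₂ p≡y = ⊥-elim (y≢p (sym p≡y))

-- The matching

module Construction {n : ℕ} {ad : Fin n → Fin n → Bool} (tree : IsTree ad)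
                    {col : Fin n → Bool} (proper : ProperColouring ad col)
                    {k : ℕ} (min-degree : ∀ x → T (not (col x)) → k ≤ degree ad x) (2≤k : 2 ≤ k)
                    {U : List (Fin n)} {v : Fin n} (v∈U : v ∈ U) (v∈A : col v ≡ false) where

  open RootedTree ad tree v

  neighbours : Fin n → List (Fin n)
  neighbours x = filterᵇ (ad x) (allFin n)

  neighbours-adjacent : ∀ x → All (x ~_) (neighbours x)
  neighbours-adjacent x = All.all-filter (T? ∘ ad x) (allFin n)

  neighbours-unique : ∀ x → Unique (neighbours x)
  neighbours-unique x = Unique.filter⁺ (T? ∘ ad x) (Unique.allFin⁺ n)

  neighbour-in-B : ∀ {x y} → col x ≡ false → x ~ y → col y ≡ true
  neighbour-in-B {x} {y} x∈A xy = trans (¬-not (≢-sym (proper x y xy))) (cong not x∈A)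

  A≢B : ∀ {x y} → col x ≡ false → col y ≡ true → x ≢ y
  A≢B x∈A y∈B refl with trans (sym x∈A) y∈B
  ... | ()

  k≤degree : ∀ {x} → col x ≡ false → k ≤ length (neighbours x)
  k≤degree {x} x∈A = min-degree x (Equivalence.from T-not-≡ x∈A)

  child : Fin n → Fin n
  child x = another _≟ᶠ_ (parent x) (neighbours x)

  child-spec : ∀ {x} → col x ≡ false → child x ∈ neighbours x × child x ≢ parent x
  child-spec {x} x∈A = another-spec _≟ᶠ_ (parent x) (≤-trans 2≤k (k≤degree x∈A)) (neighbours-unique x)

  child-adjacent : ∀ {x} → col x ≡ false → x ~ child x
  child-adjacent {x} x∈A = All.lookup (neighbours-adjacent x) (proj₁ (child-spec x∈A))

  parent-child : ∀ {x} → col x ≡ false → parent (child x) ≡ x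
  parent-child x∈A = parent-of-neighbour (child-adjacent x∈A) (proj₂ (child-spec x∈A))

  child-in-B : ∀ {x} → col x ≡ false → col (child x) ≡ true
  child-in-B x∈A = neighbour-in-B x∈A (child-adjacent x∈A)

  child-injective : ∀ {x x′} → col x ≡ false → col x′ ≡ false → child x ≡ child x′ → x ≡ x′
  child-injective x∈A x′∈A c≡c′ =
    trans (sym (parent-child x∈A)) (trans (cong parent c≡c′) (parent-child x′∈A))

  parent-of-spoke : ∀ {y} → v ~ y → parent y ≡ v
  parent-of-spoke vy = parent-of-neighbour vy (λ y≡p → ~⇒≢ vy (sym (trans y≡p parent-root)))

  child≢spoke : ∀ {x y} → col x ≡ false → x ≢ v → v ~ y → child x ≢ y
  child≢spoke x∈A x≢v vy c≡y =
    x≢v (trans (sym (parent-child x∈A)) (trans (cong parent c≡y) (parent-of-spoke vy)))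

  A-vertices : List (Fin n)
  A-vertices = filterᵇ (not ∘ col) (allFin n)

  A-vertices-unique : Unique A-vertices
  A-vertices-unique = Unique.filter⁺ (T? ∘ not ∘ col) (Unique.allFin⁺ n)

  others : List (Fin n)
  others = filter (λ x → ¬? (x ≟ᶠ v)) A-vertices

  others-spec : All (λ x → col x ≡ false × x ≢ v) others
  others-spec =
    All.zip ( All.map (Equivalence.to T-not-≡)
                      (All.filter⁺ (λ x → ¬? (x ≟ᶠ v)) (All.all-filter (T? ∘ not ∘ col) (allFin n)))
            , All.all-filter (λ x → ¬? (x ≟ᶠ v)) A-vertices)

  others-unique : Unique others
  others-unique = Unique.filter⁺ (λ x → ¬? (x ≟ᶠ v)) A-vertices-unique

  length-A-vertices : length A-vertices ≡ suc (length others)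
  length-A-vertices = length-remove _≟ᶠ_ A-vertices-unique
                        (∈-filter⁺ (T? ∘ not ∘ col) (∈-allFin v) (Equivalence.from T-not-≡ v∈A))

  spokes : List (Fin n)
  spokes = take k (neighbours v)

  length-spokes : length spokes ≡ k
  length-spokes = trans (length-take k (neighbours v)) (m≤n⇒m⊓n≡m (k≤degree v∈A))

  spokes-adjacent : All (v ~_) spokes
  spokes-adjacent = All.take⁺ k (neighbours-adjacent v)

  spokes-unique : Unique spokes
  spokes-unique = Unique.take⁺ k (neighbours-unique v)

  child-edge : Fin n → Fin n × Fin n
  child-edge x = x , child x

  spoke-edge : Fin n → Fin n × Fin n
  spoke-edge y = v , y

  matching : List (Fin n × Fin n)
  matching = map child-edge others ++ map spoke-edge spokes

  length-matching : length matching ≡ length A-vertices ∸ 1 + k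
  length-matching = begin
    length matching                                          ≡⟨ length-++ (map child-edge others) ⟩
    length (map child-edge others) + length (map spoke-edge spokes)
      ≡⟨ cong₂ _+_ (trans (length-map child-edge others) (cong (_∸ 1) (sym length-A-vertices)))
                   (trans (length-map spoke-edge spokes) length-spokes) ⟩
    length A-vertices ∸ 1 + k                                ∎
    where open ≡-Reasoning

  matching-adjacent : All (Adjacent (toGraph ad)) matching
  matching-adjacent =
    All.++⁺ (All.map⁺ (All.map (child-adjacent ∘ proj₁) others-spec)) (All.map⁺ spokes-adjacent)

  child-edges-disjoint : ∀ {x x′} → col x ≡ false × x ≢ v → col x′ ≡ false × x′ ≢ v → x ≢ x′ →
                         DisjointAfterSplitting U (child-edge x) (child-edge x′)
  child-edges-disjoint (x∈A , _) (x′∈A , _) x≢x′ =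
    ends-apart x≢x′ , ends-apart (A≢B x∈A (child-in-B x′∈A)) ,
    ends-apart (≢-sym (A≢B x′∈A (child-in-B x∈A))) , ends-apart (x≢x′ ∘ child-injective x∈A x′∈A)

  spoke-edges-disjoint : ∀ {y y′} → v ~ y → v ~ y′ → y ≢ y′ →
                         DisjointAfterSplitting U (spoke-edge y) (spoke-edge y′)
  spoke-edges-disjoint vy vy′ y≢y′ =
    (λ _ → v∈U , y≢y′) , ends-apart (A≢B v∈A (neighbour-in-B v∈A vy′)) ,
    ends-apart (≢-sym (A≢B v∈A (neighbour-in-B v∈A vy))) , ends-apart y≢y′

  child-spoke-disjoint : ∀ {x y} → col x ≡ false × x ≢ v → v ~ y →
                         DisjointAfterSplitting U (child-edge x) (spoke-edge y)
  child-spoke-disjoint (x∈A , x≢v) vy =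
    ends-apart x≢v , ends-apart (A≢B x∈A (neighbour-in-B v∈A vy)) ,
    ends-apart (≢-sym (A≢B v∈A (child-in-B x∈A))) , ends-apart (child≢spoke x∈A x≢v vy)

  matching-disjoint : AllPairs (DisjointAfterSplitting U) matching
  matching-disjoint =
    AllPairs.++⁺ (AllPairs.map⁺ (allPairs-within child-edges-disjoint others-spec others-unique))
                 (AllPairs.map⁺ (allPairs-within spoke-edges-disjoint spokes-adjacent spokes-unique))
                 (All.map⁺ (All.map (λ x-spec → All.map⁺ (All.map (child-spoke-disjoint x-spec) spokes-adjacent))
                                    others-spec))

lemma2p8 : (n : ℕ) (ad : Fin n → Fin n → Bool) → IsTree ad →
           (col : Fin n → Bool) → ProperColouring ad col →
           sizeOf (λ x → not (col x)) ≤ sizeOf col →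
           (k : ℕ) → IsMinDegOn ad (λ x → not (col x)) k → 2 ≤ k →
           (U : List (Fin n)) (H : Graph) → SplitsOn (toGraph ad) U H →
           Σ (Fin n) (λ u → u ∈ U × col u ≡ false) →
           matchingNumber≥ H (sizeOf (λ x → not (col x)) ∸ 1 + k)
lemma2p8 n ad tree@(simple , _) col proper _ k (min-degree , _) 2≤k U H splits (v , v∈U , v∈A) =
  subst (matchingNumber≥ H) length-matching
    (splitting-separates splits (simple⇒undirected simple) (simple⇒loopless simple)
                         matching matching-adjacent matching-disjoint)
  where open Construction tree proper min-degree 2≤k v∈U v∈A
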